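{- For every positive integer $k$ that is not prime, $\bar{g}(k) > 0$.
   Context: For a non-negative integer $k$, $\bar{g}(k)$ is the greatest integer $n$ such that there exists a strictly increasing sequence of integers $n = a_1 < a_2 < \cdots < a_t = k$ ($t \geq 1$) whose product $a_1 a_2 \cdots a_t$ is a perfect square. -}

module Defs where

open import Data.Nat using (ℕ; _*_; _<_; _≤_)
open import Data.List using (List; _∷_; last)
open import Data.Nat.ListAction using (product)
open import Data.List.Relation.Unary.Linked using (Linked)
open import Data.Maybe using (just)
open import Data.Product using (Σ; ∃; _×_)
open import Relation.Binary.PropositionalEquality using (_≡_)

IsSquare : ℕ → Set
IsSquare m = ∃ λ r → m ≡ r * r

-- Admissible n k : there is a strictly increasing sequence
-- n = a₁ < a₂ < ⋯ < a_t = k (t ≥ 1), given as the list n ∷ rest,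
-- whose product is a perfect square.
Admissible : ℕ → ℕ → Set
Admissible n k =
  Σ (List ℕ) λ rest →
    Linked _<_ (n ∷ rest) × last (n ∷ rest) ≡ just k × IsSquare (product (n ∷ rest))

IsGbar : ℕ → ℕ → Set
IsGbar k g = Admissible g k × (∀ m → Admissible m k → m ≤ g)

-- A non-prime k > 0 is either a perfect square (this includes k = 1) or a product
-- a·b with 1 < a < b < k; then the chain (k), respectively (a, b, k) with product k²,
-- has square product, so some positive n is admissible for k. Admissibility is
-- decidable (a chain from n to k is one of finitely many lists) and forces n ≤ k, so
-- a greatest admissible n exists, and it is at least that positive one.
module Submission where

open import Defs
open import Data.Nat using (ℕ; zero; suc; _*_; _∸_; _<_; _≤_; z≤n; s≤s; s≤s⁻¹; _<?_; _≤?_; _≟_; >-nonZero; nonTrivial⇒n>1)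
open import Data.Nat.Properties
open import Data.Nat.ListAction using (product)
open import Data.Nat.Primality using (Prime; composite; ¬prime⇒composite)
open import Data.Nat.Divisibility using (divides)
open import Data.List using (List; []; _∷_; last)
open import Data.List.Relation.Unary.Linked using (Linked; [-]; _∷_)
open import Data.Maybe using (just)
open import Data.Maybe.Properties using (just-injective)
open import Data.Product using (∃; _×_; _,_; proj₁; proj₂)
open import Data.Sum using (_⊎_; inj₁; inj₂)
open import Function using (_∘_; _⇔_; mk⇔)
open import Relation.Binary.Definitions using (tri<; tri≈; tri>)
open import Relation.Nullary using (¬_; Dec; yes; no)
open import Relation.Nullary.Decidable as Dec using (map′; _×-dec_; _⊎-dec_)
open import Relation.Unary using (Pred; Decidable)
open import Relation.Binary.PropositionalEquality

Linked<-head≤last : ∀ {a k} rest → Linked _<_ (a ∷ rest) → last (a ∷ rest) ≡ just k → a ≤ k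
Linked<-head≤last []         _              eq = ≤-reflexive (just-injective eq)
Linked<-head≤last (b ∷ rest) (a<b ∷ linked) eq = <⇒≤ (<-≤-trans a<b (Linked<-head≤last rest linked eq))

Admissible⇒≤ : ∀ {n k} → Admissible n k → n ≤ k
Admissible⇒≤ (rest , linked , eq , _) = Linked<-head≤last rest linked eq

square? : Decidable IsSquare
square? m = map′ fromBounded toBounded (anyUpTo? (λ r → m ≟ r * r) (suc m))
  where
  fromBounded : (∃ λ r → r < suc m × m ≡ r * r) → IsSquare m
  fromBounded (r , _ , eq) = r , eq
  root≤ : ∀ r → r ≤ r * r
  root≤ zero    = z≤n
  root≤ (suc r) = m≤m*n (suc r) (suc r)
  toBounded : IsSquare m → ∃ λ r → r < suc m × m ≡ r * r
  toBounded (r , eq) = r , s≤s (≤-trans (root≤ r) (≤-reflexive (sym eq))) , eq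

-- Dropping the head a of a chain moves it into the scale c; this is what makes
-- admissibility decidable by recursion along the chain.
ScaledAdmissible : ℕ → ℕ → ℕ → Set
ScaledAdmissible c n k =
  ∃ λ rest → Linked _<_ (n ∷ rest) × last (n ∷ rest) ≡ just k × IsSquare (c * product (n ∷ rest))

ScaledAdmissible⇒≤ : ∀ {c n k} → ScaledAdmissible c n k → n ≤ k
ScaledAdmissible⇒≤ (rest , linked , eq , _) = Linked<-head≤last rest linked eq

ScaledAdmissible₁⇔Admissible : ∀ {n k} → ScaledAdmissible 1 n k ⇔ Admissible n k
ScaledAdmissible₁⇔Admissible = mk⇔
  (λ (rest , linked , eq , sq) → rest , linked , eq , subst IsSquare (*-identityˡ _) sq)
  (λ (rest , linked , eq , sq) → rest , linked , eq , subst IsSquare (sym (*-identityˡ _)) sq)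

ScaledStep : ℕ → ℕ → ℕ → Set
ScaledStep c a k = (a ≡ k × IsSquare (c * a)) ⊎ (∃ λ b → b < suc k × a < b × ScaledAdmissible (c * a) b k)

ScaledStep⇔ScaledAdmissible : ∀ c {a k} → ScaledStep c a k ⇔ ScaledAdmissible c a k
ScaledStep⇔ScaledAdmissible c = mk⇔ ScaledStep⇒ScaledAdmissible ScaledAdmissible⇒ScaledStep
  where
  ScaledAdmissible⇒ScaledStep : ∀ {a k} → ScaledAdmissible c a k → ScaledStep c a k
  ScaledAdmissible⇒ScaledStep {a} ([] , _ , eq , sq) =
    inj₁ (just-injective eq , subst IsSquare (cong (c *_) (*-identityʳ a)) sq)
  ScaledAdmissible⇒ScaledStep {a} (b ∷ rest , a<b ∷ linked , eq , sq) =
    inj₂ (b , s≤s (Linked<-head≤last rest linked eq) , a<b ,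
          (rest , linked , eq , subst IsSquare (sym (*-assoc c a _)) sq))

  ScaledStep⇒ScaledAdmissible : ∀ {a k} → ScaledStep c a k → ScaledAdmissible c a k
  ScaledStep⇒ScaledAdmissible {a} (inj₁ (refl , sq)) =
    [] , [-] , refl , subst IsSquare (cong (c *_) (sym (*-identityʳ a))) sq
  ScaledStep⇒ScaledAdmissible {a} (inj₂ (b , _ , a<b , (rest , linked , eq , sq))) =
    b ∷ rest , a<b ∷ linked , eq , subst IsSquare (*-assoc c a _) sq

-- The fuel only bounds k ∸ a, which drops with each head removed.
scaledAdmissible? : ∀ fuel c a k → k ∸ a < fuel → Dec (ScaledAdmissible c a k)
scaledAdmissible? (suc fuel) c a k k∸a<fuel =
  Dec.map (ScaledStep⇔ScaledAdmissible c)
          ((a ≟ k ×-dec square? (c * a)) ⊎-dec anyUpTo? continues? (suc k))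
  where
  continues? : ∀ b → Dec (a < b × ScaledAdmissible (c * a) b k)
  continues? b with a <? b | b ≤? k
  ... | no a≮b  | _       = no (a≮b ∘ proj₁)
  ... | yes _   | no b≰k  = no (b≰k ∘ ScaledAdmissible⇒≤ {c * a} ∘ proj₂)
  ... | yes a<b | yes b≤k =
    map′ (a<b ,_) proj₂
         (scaledAdmissible? fuel (c * a) b k (<-≤-trans (∸-monoʳ-< a<b b≤k) (s≤s⁻¹ k∸a<fuel)))

admissible? : ∀ k → Decidable (λ n → Admissible n k)
admissible? k n =
  Dec.map ScaledAdmissible₁⇔Admissible (scaledAdmissible? (suc k) 1 n k (s≤s (m∸n≤m k n)))

∃-greatest : ∀ {p} {P : Pred ℕ p} → Decidable P → ∀ j → (∀ m → P m → m ≤ j) →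
           ∀ {n} → P n → ∃ λ g → P g × (∀ m → P m → m ≤ g)
∃-greatest P? zero    bounded {n} Pn = n , Pn , λ m Pm → ≤-trans (bounded m Pm) z≤n
∃-greatest {P = P} P? (suc j) bounded Pn with P? (suc j)
... | yes Pj = suc j , Pj , bounded
... | no ¬Pj = ∃-greatest P? j bounded′ Pn
  where
  bounded′ : ∀ m → P m → m ≤ j
  bounded′ m Pm = s≤s⁻¹ (≤∧≢⇒< (bounded m Pm) λ { refl → ¬Pj Pm })

square⇒Admissible-self : ∀ {k} → IsSquare k → Admissible k k
square⇒Admissible-self {k} sq = [] , [-] , refl , subst IsSquare (sym (*-identityʳ k)) sq

factorisation⇒Admissible : ∀ {a b k} → a < b → b < k → a * b ≡ k → Admissible a k
factorisation⇒Admissible {a} {b} {k} a<b b<k ab≡k =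
  b ∷ k ∷ [] , a<b ∷ b<k ∷ [-] , refl , (k , product≡k²)
  where
  open ≡-Reasoning
  product≡k² : a * (b * (k * 1)) ≡ k * k
  product≡k² = begin
    a * (b * (k * 1)) ≡⟨ *-assoc a b (k * 1) ⟨
    a * b * (k * 1)   ≡⟨ cong₂ _*_ ab≡k (*-identityʳ k) ⟩
    k * k             ∎

¬prime⇒positive-Admissible : ∀ k → 0 < k → ¬ Prime k → ∃ λ n → 0 < n × Admissible n k
¬prime⇒positive-Admissible 1 _ _ = 1 , s≤s z≤n , square⇒Admissible-self (1 , refl)
¬prime⇒positive-Admissible k@(suc (suc _)) _ ¬prime with ¬prime⇒composite ¬prime
... | composite {d} d<k (divides q k≡qd) with <-cmp q d
...   | tri< q<d _ _ = q , 0<q , factorisation⇒Admissible q<d d<k (sym k≡qd)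
  where
  0<q : 0 < q
  0<q = n≢0⇒n>0 λ { refl → 0≢1+n (sym k≡qd) }
...   | tri≈ _ refl _ = k , s≤s z≤n , square⇒Admissible-self (q , k≡qd)
...   | tri> _ _ d<q = d , 0<d , factorisation⇒Admissible d<q q<k (trans (*-comm d q) (sym k≡qd))
  where
  0<d : 0 < d
  0<d = <-trans (s≤s z≤n) (nonTrivial⇒n>1 d)
  q<k : q < k
  q<k = subst (q <_) (sym k≡qd) (m<m*n q d {{>-nonZero (<-trans 0<d d<q)}} (nonTrivial⇒n>1 d))

lemma1p11 : (k : ℕ) → 0 < k → ¬ Prime k → ∃ λ g → IsGbar k g × 0 < g
lemma1p11 k 0<k ¬prime =
  let n , 0<n , admissible-n = ¬prime⇒positive-Admissible k 0<k ¬prime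
      g , admissible-g , maximal = ∃-greatest (admissible? k) k (λ _ → Admissible⇒≤) admissible-n
  in g , (admissible-g , maximal) , <-≤-trans 0<n (maximal n admissible-n)
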